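{- As formal power series in $x$ (with integer coefficients), $$\sqrt{\frac{1}{(1-x)(1+3x)}}\equiv \prod_{k=0}^\infty (1-x^{2^k}) \pmod 4 \quad\text{and}\quad \sqrt{\frac{1}{(1-x)(1+3x)}}\equiv \prod_{k=0}^\infty (1-x^{3^k}) \pmod 3.$$
   Context: The square root denotes the formal power series with constant term $1$ whose square is $1/((1-x)(1+3x))$; it has integer coefficients. Congruence of power series modulo $m$ means coefficientwise congruence modulo $m$. -}

module Defs where

open import Data.Nat as ℕ using (ℕ; zero; suc; _∸_; _^_)
open import Data.Integer using (ℤ; +_; -[1+_]; _+_; _*_; _-_; -_)
open import Data.Integer.Divisibility using (_∣_)
open import Data.Bool using (if_then_else_)

PS : Set
PS = ℕ → ℤ

sumTo : ℕ → (ℕ → ℤ) → ℤ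
sumTo zero    f = f 0
sumTo (suc n) f = sumTo n f + f (suc n)

_⊛_ : PS → PS → PS
(f ⊛ g) n = sumTo n (λ i → f i * g (n ∸ i))

infixl 7 _⊛_

oneS : PS
oneS zero    = + 1
oneS (suc _) = + 0

xPow : ℕ → PS
xPow m n = if m ℕ.≡ᵇ n then + 1 else + 0

linear : ℤ → ℤ → PS
linear a b zero          = a
linear a b (suc zero)    = b
linear a b (suc (suc _)) = + 0

oneMinusXPow : ℕ → PS
oneMinusXPow m n = oneS n - xPow m n

partialProd : ℕ → ℕ → PS
partialProd b zero    = oneMinusXPow (b ^ 0)
partialProd b (suc K) = partialProd b K ⊛ oneMinusXPow (b ^ suc K)

-- the infinite product ∏_{k≥0} (1 - x^{b^k}) for b ≥ 2: its n-th coefficient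
-- equals that of the finite product over k ≤ n, since b^k > n for k > n.
infProd : ℕ → PS
infProd b n = partialProd b n n

_≡PS_[mod_] : PS → PS → ℕ → Set
f ≡PS g [mod m ] = ∀ n → (+ m) ∣ (f n - g n)

module Submission where

-- Write E(y) = (1 - y)(1 + 3y) = 1 + 2y - 3y². Expanding shows (1 - y)² E(y) ≡ E(y²) (mod 8)
-- and (1 - y)² E(y) ≡ E(y³) (mod 3). With (b, M) = (2, 8) or (3, 3), induction then gives
-- P_K² E(x) ≡ E(x^(b^(K+1))) (mod M) for the partial products P_K = ∏_{k≤K} (1 - x^(b^k)), and
-- comparing coefficients below b^(K+1) yields P² E(x) ≡ 1 (mod M) for the infinite product P.
-- So the root s satisfies (s - P)(s + P) E(x) ≡ 0 (mod M); as E(0) = 1 the factor E(x) cancels,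
-- and since s + P has constant term 2 an induction on coefficients gives s ≡ P modulo 4
-- (from M = 8) and modulo 3.

open import Defs
open import Algebra.Bundles using (CommutativeRing)
import Algebra.Construct.Pointwise as Pointwise
open import Algebra.Solver.Ring.AlmostCommutativeRing using (fromCommutativeRing; _-Raw-AlmostCommutative⟶_)
open import Data.Integer as ℤ using (ℤ; +_; -[1+_]; _+_; _*_; _-_; -_; 0ℤ; 1ℤ)
open import Data.Integer.Divisibility.Signed
  using (_∣_; divides; ∣-refl; ∣-trans; ∣m∣n⇒∣m+n; ∣m∣n⇒∣m-n; ∣m+n∣m⇒∣n; ∣m⇒∣m*n; ∣n⇒∣m*n; ∣m⇒∣-m;
         *-cancelʳ-∣; ∣⇒∣ᵤ)
import Data.Integer.Properties as ℤₚ
import Data.Integer.Tactic.RingSolver as ℤ-Solver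
open import Data.Maybe using (Maybe; just; nothing)
open import Data.Nat as ℕ using (ℕ; zero; suc; _∸_; _≤_; _<_; z≤n; s≤s; _^_)
open import Data.Nat.Induction using (<-rec)
import Data.Nat.Properties as ℕₚ
open import Data.Product using (_×_; _,_)
open import Data.Sum using (inj₁; inj₂)
open import Function using (_∘_)
open import Level using (0ℓ)
open import Relation.Binary.Bundles using (Preorder)
open import Relation.Binary.PropositionalEquality
open import Relation.Nullary using (yes; no; contradiction)

open import Algebra.Properties.CommutativeSemigroup ℤₚ.+-commutativeSemigroup using (interchange)

-- Finite sums

sumTo-cong : ∀ n {f g : ℕ → ℤ} → (∀ i → i ≤ n → f i ≡ g i) → sumTo n f ≡ sumTo n g
sumTo-cong zero    f≡g = f≡g 0 z≤n
sumTo-cong (suc n) f≡g =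
  cong₂ _+_ (sumTo-cong n (λ i i≤n → f≡g i (ℕₚ.m≤n⇒m≤1+n i≤n))) (f≡g (suc n) ℕₚ.≤-refl)

sumTo-zero : ∀ n {f : ℕ → ℤ} → (∀ i → i ≤ n → f i ≡ 0ℤ) → sumTo n f ≡ 0ℤ
sumTo-zero zero    f≡0 = f≡0 0 z≤n
sumTo-zero (suc n) f≡0 =
  cong₂ _+_ (sumTo-zero n (λ i i≤n → f≡0 i (ℕₚ.m≤n⇒m≤1+n i≤n))) (f≡0 (suc n) ℕₚ.≤-refl)

sumTo-+ : ∀ n (f g : ℕ → ℤ) → sumTo n (λ i → f i + g i) ≡ sumTo n f + sumTo n g
sumTo-+ zero    f g = refl
sumTo-+ (suc n) f g = trans (cong (_+ (f (suc n) + g (suc n))) (sumTo-+ n f g))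
  (interchange (sumTo n f) (sumTo n g) (f (suc n)) (g (suc n)))

sumTo-*ˡ : ∀ n c (f : ℕ → ℤ) → sumTo n (λ i → c * f i) ≡ c * sumTo n f
sumTo-*ˡ zero    c f = refl
sumTo-*ˡ (suc n) c f = trans (cong (_+ c * f (suc n)) (sumTo-*ˡ n c f))
  (sym (ℤₚ.*-distribˡ-+ c (sumTo n f) (f (suc n))))

sumTo-*ʳ : ∀ n c (f : ℕ → ℤ) → sumTo n (λ i → f i * c) ≡ sumTo n f * c
sumTo-*ʳ zero    c f = refl
sumTo-*ʳ (suc n) c f = trans (cong (_+ f (suc n) * c) (sumTo-*ʳ n c f))
  (sym (ℤₚ.*-distribʳ-+ c (sumTo n f) (f (suc n))))

sumTo-suc-head : ∀ n (f : ℕ → ℤ) → sumTo (suc n) f ≡ f 0 + sumTo n (λ i → f (suc i))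
sumTo-suc-head zero    f = refl
sumTo-suc-head (suc n) f = trans (cong (_+ f (suc (suc n))) (sumTo-suc-head n f))
  (ℤₚ.+-assoc (f 0) _ _)

sumTo-reverse : ∀ n (f : ℕ → ℤ) → sumTo n f ≡ sumTo n (λ i → f (n ∸ i))
sumTo-reverse zero    f = refl
sumTo-reverse (suc n) f = begin
  sumTo n f + f (suc n)                           ≡⟨ cong (_+ f (suc n)) (sumTo-reverse n f) ⟩
  sumTo n (λ i → f (n ∸ i)) + f (suc n)           ≡⟨ ℤₚ.+-comm _ (f (suc n)) ⟩
  f (suc n) + sumTo n (λ i → f (suc n ∸ suc i))   ≡⟨ sumTo-suc-head n (λ i → f (suc n ∸ i)) ⟨
  sumTo (suc n) (λ i → f (suc n ∸ i))             ∎
  where open ≡-Reasoning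

sumTo-single : ∀ n j (f : ℕ → ℤ) → j ≤ n → (∀ i → i ≢ j → f i ≡ 0ℤ) → sumTo n f ≡ f j
sumTo-single zero    zero f z≤n f≡0 = refl
sumTo-single (suc n) j    f j≤1+n f≡0 with ℕₚ.m≤n⇒m<n∨m≡n j≤1+n
... | inj₁ (s≤s j≤n) = trans (cong₂ _+_ (sumTo-single n j f j≤n f≡0)
                               (f≡0 (suc n) (ℕₚ.<⇒≢ (s≤s j≤n) ∘ sym)))
                             (ℤₚ.+-identityʳ (f j))
... | inj₂ refl      = trans (cong (_+ f (suc n))
                               (sumTo-zero n (λ i i≤n → f≡0 i (ℕₚ.<⇒≢ (s≤s i≤n)))))
                             (ℤₚ.+-identityˡ (f (suc n)))

sumTo-triangle : ∀ n (F : ℕ → ℕ → ℤ) →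
  sumTo n (λ i → sumTo i (F i)) ≡ sumTo n (λ j → sumTo (n ∸ j) (λ k → F (j ℕ.+ k) j))
sumTo-triangle zero    F = refl
sumTo-triangle (suc n) F = begin
  sumTo n (λ i → sumTo i (F i)) + sumTo (suc n) (F (suc n))
    ≡⟨ cong (_+ sumTo (suc n) (F (suc n))) (sumTo-triangle n F) ⟩
  sumTo n G + (sumTo n (F (suc n)) + F (suc n) (suc n))
    ≡⟨ ℤₚ.+-assoc (sumTo n G) _ _ ⟨
  sumTo n G + sumTo n (F (suc n)) + F (suc n) (suc n)
    ≡⟨ cong₂ _+_ (sym (sumTo-+ n G (F (suc n)))) last ⟩
  sumTo n (λ j → G j + F (suc n) j) + G′ (suc n)
    ≡⟨ cong (_+ G′ (suc n)) (sumTo-cong n step) ⟩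
  sumTo n G′ + G′ (suc n) ∎
  where
  open ≡-Reasoning
  G G′ : ℕ → ℤ
  G  j = sumTo (n ∸ j) (λ k → F (j ℕ.+ k) j)
  G′ j = sumTo (suc n ∸ j) (λ k → F (j ℕ.+ k) j)
  last : F (suc n) (suc n) ≡ G′ (suc n)
  last = begin
    F (suc n) (suc n)                                  ≡⟨ cong (λ m → F m (suc n)) (ℕₚ.+-identityʳ (suc n)) ⟨
    F (suc n ℕ.+ 0) (suc n)                            ≡⟨ cong (λ m → sumTo m (λ k → F (suc n ℕ.+ k) (suc n))) (ℕₚ.n∸n≡0 n) ⟨
    G′ (suc n)                                         ∎
  step : ∀ j → j ≤ n → G j + F (suc n) j ≡ G′ j
  step j j≤n rewrite ℕₚ.+-∸-assoc 1 j≤n =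
    cong (λ m → G j + F m j) (sym (trans (ℕₚ.+-suc j (n ∸ j)) (cong suc (ℕₚ.m+[n∸m]≡n j≤n))))

-- The ring of power series

infix  4 _≈_
infixl 6 _⊕_
infix  8 ⊝_

_≈_ : PS → PS → Set
f ≈ g = ∀ n → f n ≡ g n

_⊕_ : PS → PS → PS
(f ⊕ g) n = f n + g n

⊝_ : PS → PS
(⊝ f) n = - f n

zeroS : PS
zeroS _ = 0ℤ

constS : ℤ → PS
constS c zero    = c
constS c (suc _) = 0ℤ

⊛-cong : ∀ {f f′ g g′} → f ≈ f′ → g ≈ g′ → f ⊛ g ≈ f′ ⊛ g′
⊛-cong f≈f′ g≈g′ n = sumTo-cong n (λ i _ → cong₂ _*_ (f≈f′ i) (g≈g′ (n ∸ i)))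

⊛-congˡ : ∀ f {g g′} → g ≈ g′ → f ⊛ g ≈ f ⊛ g′
⊛-congˡ f = ⊛-cong {f} (λ _ → refl)

⊛-congʳ : ∀ {f f′} g → f ≈ f′ → f ⊛ g ≈ f′ ⊛ g
⊛-congʳ g f≈f′ = ⊛-cong {g = g} f≈f′ (λ _ → refl)

⊛-comm : ∀ f g → f ⊛ g ≈ g ⊛ f
⊛-comm f g n = trans (sumTo-reverse n _) (sumTo-cong n (λ i i≤n →
  trans (cong (λ k → f (n ∸ i) * g k) (ℕₚ.m∸[m∸n]≡n i≤n)) (ℤₚ.*-comm (f (n ∸ i)) (g i))))

⊛-assoc : ∀ f g h → (f ⊛ g) ⊛ h ≈ f ⊛ (g ⊛ h)
⊛-assoc f g h n = begin
  sumTo n (λ i → sumTo i (λ j → f j * g (i ∸ j)) * h (n ∸ i))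
    ≡⟨ sumTo-cong n (λ i _ → sym (sumTo-*ʳ i (h (n ∸ i)) _)) ⟩
  sumTo n (λ i → sumTo i (λ j → f j * g (i ∸ j) * h (n ∸ i)))
    ≡⟨ sumTo-triangle n _ ⟩
  sumTo n (λ j → sumTo (n ∸ j) (λ k → f j * g (j ℕ.+ k ∸ j) * h (n ∸ (j ℕ.+ k))))
    ≡⟨ sumTo-cong n (λ j _ → trans (sumTo-cong (n ∸ j) (λ k _ → regroup j k))
                                   (sumTo-*ˡ (n ∸ j) (f j) _)) ⟩
  sumTo n (λ j → f j * sumTo (n ∸ j) (λ k → g k * h (n ∸ j ∸ k))) ∎
  where
  open ≡-Reasoning
  regroup : ∀ j k → f j * g (j ℕ.+ k ∸ j) * h (n ∸ (j ℕ.+ k)) ≡ f j * (g k * h (n ∸ j ∸ k))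
  regroup j k rewrite ℕₚ.m+n∸m≡n j k | ℕₚ.∸-+-assoc n j k = ℤₚ.*-assoc (f j) (g k) _

constS-⊛ : ∀ c f → constS c ⊛ f ≈ (λ n → c * f n)
constS-⊛ c f n = sumTo-single n 0 _ z≤n λ
  { zero    0≢0 → contradiction refl 0≢0
  ; (suc i) _   → ℤₚ.*-zeroˡ (f (n ∸ suc i)) }

⊛-identityˡ : ∀ f → oneS ⊛ f ≈ f
⊛-identityˡ f n = trans (sumTo-single n 0 _ z≤n λ
  { zero    0≢0 → contradiction refl 0≢0
  ; (suc i) _   → ℤₚ.*-zeroˡ (f (n ∸ suc i)) }) (ℤₚ.*-identityˡ (f n))

⊛-distribˡ : ∀ f g h → f ⊛ (g ⊕ h) ≈ f ⊛ g ⊕ f ⊛ h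
⊛-distribˡ f g h n = trans (sumTo-cong n (λ i _ → ℤₚ.*-distribˡ-+ (f i) (g (n ∸ i)) (h (n ∸ i))))
  (sumTo-+ n _ _)

⊛-distribʳ : ∀ f g h → (g ⊕ h) ⊛ f ≈ g ⊛ f ⊕ h ⊛ f
⊛-distribʳ f g h n = trans (sumTo-cong n (λ i _ → ℤₚ.*-distribʳ-+ (f (n ∸ i)) (g i) (h i)))
  (sumTo-+ n _ _)

PS-commutativeRing : CommutativeRing 0ℓ 0ℓ
PS-commutativeRing = record
  { Carrier = PS ; _≈_ = _≈_ ; _+_ = _⊕_ ; _*_ = _⊛_ ; -_ = ⊝_ ; 0# = zeroS ; 1# = oneS
  ; isCommutativeRing = record
    { isRing = record
      { +-isAbelianGroup = Pointwise.isAbelianGroup ℕ ℤₚ.+-0-isAbelianGroup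
      ; *-cong           = ⊛-cong
      ; *-assoc          = ⊛-assoc
      ; *-identity       = ⊛-identityˡ , λ f n → trans (⊛-comm f oneS n) (⊛-identityˡ f n)
      ; distrib          = ⊛-distribˡ , ⊛-distribʳ
      }
    ; *-comm = ⊛-comm
    }
  }

constS-morphism : CommutativeRing.rawRing ℤₚ.+-*-commutativeRing
  -Raw-AlmostCommutative⟶ fromCommutativeRing PS-commutativeRing
constS-morphism = record
  { ⟦_⟧    = constS
  ; +-homo = λ { a b zero → refl ; a b (suc n) → refl }
  ; *-homo = λ a b n → sym (trans (constS-⊛ a (constS b) n) (*-homo a b n))
  ; -‿homo = λ { a zero → refl ; a (suc n) → refl }
  ; 0-homo = λ { zero → refl ; (suc n) → refl }
  ; 1-homo = λ { zero → refl ; (suc n) → refl }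
  }
  where
  *-homo : ∀ a b n → a * constS b n ≡ constS (a * b) n
  *-homo a b zero    = refl
  *-homo a b (suc n) = ℤₚ.*-zeroʳ a

constS-≟ : ∀ a b → Maybe (constS a ≈ constS b)
constS-≟ a b with a ℤ.≟ b
... | yes refl = just (λ _ → refl)
... | no  _    = nothing

open import Algebra.Solver.Ring (CommutativeRing.rawRing ℤₚ.+-*-commutativeRing)
  (fromCommutativeRing PS-commutativeRing) constS-morphism constS-≟
  using (solve; _:=_; con; _:+_; _:*_; _:-_)

xPow-≢ : ∀ a n → a ≢ n → xPow a n ≡ 0ℤ
xPow-≢ zero    zero    0≢0 = contradiction refl 0≢0
xPow-≢ zero    (suc n) _   = refl
xPow-≢ (suc a) zero    _   = refl
xPow-≢ (suc a) (suc n) a≢n = xPow-≢ a n (a≢n ∘ cong suc)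

xPow-refl : ∀ a → xPow a a ≡ 1ℤ
xPow-refl zero    = refl
xPow-refl (suc a) = xPow-refl a

xPow-+-cancelˡ : ∀ a b n → xPow (a ℕ.+ b) (a ℕ.+ n) ≡ xPow b n
xPow-+-cancelˡ zero    b n = refl
xPow-+-cancelˡ (suc a) b n = xPow-+-cancelˡ a b n

xPow-⊛-< : ∀ a f {n} → n < a → (xPow a ⊛ f) n ≡ 0ℤ
xPow-⊛-< a f {n} n<a = sumTo-zero n λ i i≤n →
  trans (cong (_* f (n ∸ i)) (xPow-≢ a i λ { refl → ℕₚ.<⇒≱ n<a i≤n })) (ℤₚ.*-zeroˡ (f (n ∸ i)))

xPow-⊛-+ : ∀ a f n → (xPow a ⊛ f) (a ℕ.+ n) ≡ f n
xPow-⊛-+ a f n = begin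
  (xPow a ⊛ f) (a ℕ.+ n)          ≡⟨ sumTo-single (a ℕ.+ n) a _ (ℕₚ.m≤m+n a n) (λ i i≢a →
                                      trans (cong (_* f (a ℕ.+ n ∸ i)) (xPow-≢ a i (i≢a ∘ sym)))
                                            (ℤₚ.*-zeroˡ (f (a ℕ.+ n ∸ i)))) ⟩
  xPow a a * f (a ℕ.+ n ∸ a)      ≡⟨ cong₂ _*_ (xPow-refl a) (cong f (ℕₚ.m+n∸m≡n a n)) ⟩
  1ℤ * f n                        ≡⟨ ℤₚ.*-identityˡ (f n) ⟩
  f n                             ∎
  where open ≡-Reasoning

xPow-+ : ∀ a b → xPow a ⊛ xPow b ≈ xPow (a ℕ.+ b)
xPow-+ a b n with ℕₚ.<-≤-connex n a
... | inj₁ n<a = trans (xPow-⊛-< a (xPow b) n<a)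
                       (sym (xPow-≢ (a ℕ.+ b) n λ { refl → ℕₚ.<⇒≱ n<a (ℕₚ.m≤m+n a b) }))
... | inj₂ a≤n = subst (λ k → (xPow a ⊛ xPow b) k ≡ xPow (a ℕ.+ b) k) (ℕₚ.m+[n∸m]≡n a≤n)
                   (trans (xPow-⊛-+ a (xPow b) (n ∸ a)) (sym (xPow-+-cancelˡ a b (n ∸ a))))

-- Congruence modulo m

infix 4 _∣ₛ_ _≈_[mod_]

_∣ₛ_ : ℕ → PS → Set
m ∣ₛ f = ∀ n → + m ∣ f n

-- A record rather than a function, so that f and g can be inferred from a goal.
record _≈_[mod_] (f g : PS) (m : ℕ) : Set where
  constructor mk-mod
  field ∣-diff : m ∣ₛ f ⊕ ⊝ g

open _≈_[mod_]

∣0 : ∀ {k} → k ∣ 0ℤ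
∣0 {k} = divides 0ℤ (sym (ℤₚ.*-zeroˡ k))

∣-sumTo : ∀ {k} n {f : ℕ → ℤ} → (∀ i → i ≤ n → k ∣ f i) → k ∣ sumTo n f
∣-sumTo zero    k∣f = k∣f 0 z≤n
∣-sumTo (suc n) k∣f =
  ∣m∣n⇒∣m+n (∣-sumTo n (λ i i≤n → k∣f i (ℕₚ.m≤n⇒m≤1+n i≤n))) (k∣f (suc n) ℕₚ.≤-refl)

∣ₛ-resp-≈ : ∀ {m f g} → f ≈ g → m ∣ₛ f → m ∣ₛ g
∣ₛ-resp-≈ {m} f≈g m∣f n = subst (+ m ∣_) (f≈g n) (m∣f n)

∣ₛ-⊛ʳ : ∀ {m f} g → m ∣ₛ f → m ∣ₛ f ⊛ g
∣ₛ-⊛ʳ g m∣f n = ∣-sumTo n (λ i _ → ∣m⇒∣m*n (g (n ∸ i)) (m∣f i))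

mod-reflexive : ∀ {m f g} → f ≈ g → f ≈ g [mod m ]
mod-reflexive {g = g} f≈g = mk-mod λ n →
  subst (_ ∣_) (sym (trans (cong (_- g n) (f≈g n)) (ℤₚ.+-inverseʳ (g n)))) ∣0

mod-sym : ∀ {m f g} → f ≈ g [mod m ] → g ≈ f [mod m ]
mod-sym {f = f} {g} (mk-mod f≈g) = mk-mod λ n → subst (_ ∣_) (neg-minus (f n) (g n)) (∣m⇒∣-m (f≈g n))
  where
  neg-minus : ∀ x y → - (x - y) ≡ y - x
  neg-minus = ℤ-Solver.solve-∀

mod-trans : ∀ {m f g h} → f ≈ g [mod m ] → g ≈ h [mod m ] → f ≈ h [mod m ]
mod-trans {f = f} {g} {h} (mk-mod f≈g) (mk-mod g≈h) = mk-mod λ n →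
  subst (_ ∣_) (ℤₚ.+-minus-telescope (f n) (g n) (h n)) (∣m∣n⇒∣m+n (f≈g n) (g≈h n))

≈+multiple⇒≈[mod] : ∀ {m f g} r → f ≈ g ⊕ constS (+ m) ⊛ r → f ≈ g [mod m ]
≈+multiple⇒≈[mod] {m} {f} {g} r f≈g+mr = mk-mod λ n → subst (+ m ∣_) (sym (begin
  f n - g n                          ≡⟨ cong (_- g n) (f≈g+mr n) ⟩
  g n + (constS (+ m) ⊛ r) n - g n   ≡⟨ +-minus-cancelˡ (g n) _ ⟩
  (constS (+ m) ⊛ r) n               ≡⟨ constS-⊛ (+ m) r n ⟩
  + m * r n                          ∎)) (∣m⇒∣m*n (r n) ∣-refl)
  where
  open ≡-Reasoning
  +-minus-cancelˡ : ∀ x y → x + y - x ≡ y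
  +-minus-cancelˡ = ℤ-Solver.solve-∀

mod-⊛ʳ : ∀ {m f g} h → f ≈ g [mod m ] → f ⊛ h ≈ g ⊛ h [mod m ]
mod-⊛ʳ {f = f} {g} h (mk-mod f≈g) = mk-mod (∣ₛ-resp-≈ (⊛-distribʳ-⊝ f g h) (∣ₛ-⊛ʳ h f≈g))
  where
  ⊛-distribʳ-⊝ : ∀ f g h → (f ⊕ ⊝ g) ⊛ h ≈ f ⊛ h ⊕ ⊝ (g ⊛ h)
  ⊛-distribʳ-⊝ = solve 3 (λ f g h → (f :- g) :* h := f :* h :- g :* h) (λ _ → refl)

mod-preorder : ℕ → Preorder 0ℓ 0ℓ 0ℓ
mod-preorder m = record
  { Carrier    = PS
  ; _≈_        = _≈_
  ; _≲_        = _≈_[mod m ]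
  ; isPreorder = record
    { isEquivalence = Pointwise.isEquivalence ℕ (isEquivalence {A = ℤ})
    ; reflexive     = mod-reflexive
    ; trans         = mod-trans
    }
  }

-- Squaring congruences

E : PS → PS
E y = constS 1ℤ ⊕ constS (+ 2) ⊛ y ⊕ ⊝ (constS (+ 3) ⊛ (y ⊛ y))

E-cong : ∀ {y y′} → y ≈ y′ → E y ≈ E y′
E-cong y≈y′ n = cong₂ _+_ (cong (_+_ (constS 1ℤ n)) (⊛-congˡ (constS (+ 2)) y≈y′ n))
                          (cong -_ (⊛-congˡ (constS (+ 3)) (⊛-cong y≈y′ y≈y′) n))

linear-product≈E : linear 1ℤ -[1+ 0 ] ⊛ linear 1ℤ (+ 3) ≈ E (xPow 1)
linear-product≈E n = trans (⊛-cong 1-x 1+3x n) (factorise (xPow 1) n)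
  where
  1-x : linear 1ℤ -[1+ 0 ] ≈ constS 1ℤ ⊕ ⊝ xPow 1
  1-x zero          = refl
  1-x (suc zero)    = refl
  1-x (suc (suc n)) = refl
  1+3x : linear 1ℤ (+ 3) ≈ constS 1ℤ ⊕ constS (+ 3) ⊛ xPow 1
  1+3x zero          = refl
  1+3x (suc zero)    = refl
  1+3x (suc (suc n)) = sym (cong (_+_ 0ℤ) (constS-⊛ (+ 3) (xPow 1) (suc (suc n))))
  factorise : ∀ y → (constS 1ℤ ⊕ ⊝ y) ⊛ (constS 1ℤ ⊕ constS (+ 3) ⊛ y) ≈ E y
  factorise = solve 1 (λ y → (con 1ℤ :- y) :* (con 1ℤ :+ con (+ 3) :* y)
                             := con 1ℤ :+ con (+ 2) :* y :- con (+ 3) :* (y :* y)) (λ _ → refl)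

E-xPow-< : ∀ {N n} → n < N → E (xPow N) n ≡ oneS n
E-xPow-< {N} {n} n<N = begin
  constS 1ℤ n + (constS (+ 2) ⊛ xPow N) n - (constS (+ 3) ⊛ (xPow N ⊛ xPow N)) n
    ≡⟨ cong₂ (λ u v → constS 1ℤ n + u - v)
             (trans (constS-⊛ (+ 2) (xPow N) n) (cong (+ 2 *_) (xPow-≢ N n (ℕₚ.>⇒≢ n<N))))
             (trans (constS-⊛ (+ 3) (xPow N ⊛ xPow N) n) (cong (+ 3 *_) (xPow-⊛-< N (xPow N) n<N))) ⟩
  constS 1ℤ n + 0ℤ - 0ℤ
    ≡⟨ 1+0-0 n ⟩
  oneS n ∎
  where
  open ≡-Reasoning
  1+0-0 : ∀ n → constS 1ℤ n + 0ℤ - 0ℤ ≡ oneS n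
  1+0-0 zero    = refl
  1+0-0 (suc n) = refl

1-xPow : ∀ N → oneMinusXPow N ≈ constS 1ℤ ⊕ ⊝ xPow N
1-xPow N zero    = refl
1-xPow N (suc n) = refl

xPow-*-suc : ∀ k N → xPow (suc k ℕ.* N) ≈ xPow N ⊛ xPow (k ℕ.* N)
xPow-*-suc k N n = sym (xPow-+ N (k ℕ.* N) n)

xPow-*-1 : ∀ N → xPow (1 ℕ.* N) ≈ xPow N
xPow-*-1 N n = cong (λ k → xPow k n) (ℕₚ.*-identityˡ N)

squaring-mod : ∀ {M} b N (p r : PS → PS) →
  (∀ y → ((constS 1ℤ ⊕ ⊝ y) ⊛ (constS 1ℤ ⊕ ⊝ y)) ⊛ E y ≈ E (p y) ⊕ constS (+ M) ⊛ r y) →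
  p (xPow N) ≈ xPow (b ℕ.* N) →
  (oneMinusXPow N ⊛ oneMinusXPow N) ⊛ E (xPow N) ≈ E (xPow (b ℕ.* N)) [mod M ]
squaring-mod {M} b N p r identity p[xᴺ]≈xᵇᴺ = ≈+multiple⇒≈[mod] (r y) λ n → begin
  ((oneMinusXPow N ⊛ oneMinusXPow N) ⊛ E y) n
    ≡⟨ ⊛-congʳ (E y) (⊛-cong (1-xPow N) (1-xPow N)) n ⟩
  (((constS 1ℤ ⊕ ⊝ y) ⊛ (constS 1ℤ ⊕ ⊝ y)) ⊛ E y) n
    ≡⟨ identity y n ⟩
  E (p y) n + (constS (+ M) ⊛ r y) n
    ≡⟨ cong (_+ (constS (+ M) ⊛ r y) n) (E-cong p[xᴺ]≈xᵇᴺ n) ⟩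
  E (xPow (b ℕ.* N)) n + (constS (+ M) ⊛ r y) n ∎
  where
  open ≡-Reasoning
  y = xPow N

squaring-identity-8 : ∀ y → ((constS 1ℤ ⊕ ⊝ y) ⊛ (constS 1ℤ ⊕ ⊝ y)) ⊛ E y
                            ≈ E (y ⊛ y) ⊕ constS (+ 8) ⊛ (y ⊛ (y ⊛ y) ⊕ ⊝ (y ⊛ y))
squaring-identity-8 = solve 1 (λ y →
    ((con 1ℤ :- y) :* (con 1ℤ :- y)) :* (con 1ℤ :+ con (+ 2) :* y :- con (+ 3) :* (y :* y))
  := con 1ℤ :+ con (+ 2) :* (y :* y) :- con (+ 3) :* ((y :* y) :* (y :* y))
     :+ con (+ 8) :* (y :* (y :* y) :- y :* y)) (λ _ → refl)

squaring-identity-3 : ∀ y → ((constS 1ℤ ⊕ ⊝ y) ⊛ (constS 1ℤ ⊕ ⊝ y)) ⊛ E y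
                            ≈ E (y ⊛ (y ⊛ y)) ⊕ constS (+ 3) ⊛ ((y ⊛ (y ⊛ y) ⊕ ⊝ (y ⊛ y))
                                                               ⊛ (y ⊛ (y ⊛ y) ⊕ y ⊛ y ⊕ constS (+ 2)))
squaring-identity-3 = solve 1 (λ y →
    ((con 1ℤ :- y) :* (con 1ℤ :- y)) :* (con 1ℤ :+ con (+ 2) :* y :- con (+ 3) :* (y :* y))
  := con 1ℤ :+ con (+ 2) :* (y :* (y :* y)) :- con (+ 3) :* ((y :* (y :* y)) :* (y :* (y :* y)))
     :+ con (+ 3) :* ((y :* (y :* y) :- y :* y) :* (y :* (y :* y) :+ y :* y :+ con (+ 2)))) (λ _ → refl)

squaring-mod-8 : ∀ N → (oneMinusXPow N ⊛ oneMinusXPow N) ⊛ E (xPow N) ≈ E (xPow (2 ℕ.* N)) [mod 8 ]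
squaring-mod-8 N = squaring-mod 2 N (λ y → y ⊛ y) (λ y → y ⊛ (y ⊛ y) ⊕ ⊝ (y ⊛ y)) squaring-identity-8
  λ n → sym (trans (xPow-*-suc 1 N n) (⊛-congˡ (xPow N) (xPow-*-1 N) n))

squaring-mod-3 : ∀ N → (oneMinusXPow N ⊛ oneMinusXPow N) ⊛ E (xPow N) ≈ E (xPow (3 ℕ.* N)) [mod 3 ]
squaring-mod-3 N = squaring-mod 3 N (λ y → y ⊛ (y ⊛ y))
  (λ y → (y ⊛ (y ⊛ y) ⊕ ⊝ (y ⊛ y)) ⊛ (y ⊛ (y ⊛ y) ⊕ y ⊛ y ⊕ constS (+ 2))) squaring-identity-3
  λ n → sym (trans (xPow-*-suc 2 N n) (⊛-congˡ (xPow N) (λ k →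
    trans (xPow-*-suc 1 N k) (⊛-congˡ (xPow N) (xPow-*-1 N) k)) n))

-- Partial products

infix 4 _≈_upTo_

_≈_upTo_ : PS → PS → ℕ → Set
f ≈ g upTo n = ∀ i → i ≤ n → f i ≡ g i

⊛-cong-upTo : ∀ {n f f′ g g′} → f ≈ f′ upTo n → g ≈ g′ upTo n → f ⊛ g ≈ f′ ⊛ g′ upTo n
⊛-cong-upTo f≈f′ g≈g′ i i≤n = sumTo-cong i λ j j≤i →
  cong₂ _*_ (f≈f′ j (ℕₚ.≤-trans j≤i i≤n)) (g≈g′ (i ∸ j) (ℕₚ.≤-trans (ℕₚ.m∸n≤m i j) i≤n))

n<b^n : ∀ {b} → 1 < b → ∀ n → n < b ^ n
n<b^n 1<b zero    = ℕₚ.n<1+n 0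
n<b^n 1<b (suc n) = ℕₚ.≤-<-trans (n<b^n 1<b n) (ℕₚ.^-monoʳ-< _ 1<b (ℕₚ.n<1+n n))

n<b^[1+n] : ∀ {b} → 1 < b → ∀ n → n < b ^ suc n
n<b^[1+n] 1<b n = ℕₚ.<-trans (ℕₚ.n<1+n n) (n<b^n 1<b (suc n))

partialProd-suc-< : ∀ b K {i} → i < b ^ suc K → partialProd b (suc K) i ≡ partialProd b K i
partialProd-suc-< b K {i} i<N = begin
  (A ⊛ oneMinusXPow N) i            ≡⟨ ⊛-congˡ A (1-xPow N) i ⟩
  (A ⊛ (constS 1ℤ ⊕ ⊝ xPow N)) i    ≡⟨ ⊛-1-y A (xPow N) i ⟩
  A i - (A ⊛ xPow N) i              ≡⟨ cong (λ z → A i - z) (trans (⊛-comm A (xPow N) i) (xPow-⊛-< N A i<N)) ⟩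
  A i - 0ℤ                          ≡⟨ ℤₚ.+-identityʳ (A i) ⟩
  A i                               ∎
  where
  open ≡-Reasoning
  A = partialProd b K
  N = b ^ suc K
  ⊛-1-y : ∀ f y → f ⊛ (constS 1ℤ ⊕ ⊝ y) ≈ f ⊕ ⊝ (f ⊛ y)
  ⊛-1-y = solve 2 (λ f y → f :* (con 1ℤ :- y) := f :- f :* y) (λ _ → refl)

infProd≈partialProd : ∀ {b} → 1 < b → ∀ K → infProd b ≈ partialProd b K upTo K
infProd≈partialProd 1<b zero    zero z≤n = refl
infProd≈partialProd {b} 1<b (suc K) i i≤1+K with ℕₚ.m≤n⇒m<n∨m≡n i≤1+K
... | inj₂ refl      = refl
... | inj₁ (s≤s i≤K) = trans (infProd≈partialProd 1<b K i i≤K) (sym (partialProd-suc-< b K i<N))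
  where
  i<N : i < b ^ suc K
  i<N = ℕₚ.≤-<-trans i≤K (n<b^[1+n] 1<b K)

module _ {b M : ℕ}
  (squaring : ∀ N → (oneMinusXPow N ⊛ oneMinusXPow N) ⊛ E (xPow N) ≈ E (xPow (b ℕ.* N)) [mod M ])
  where

  partialProd-square : ∀ K →
    (partialProd b K ⊛ partialProd b K) ⊛ E (xPow 1) ≈ E (xPow (b ^ suc K)) [mod M ]
  partialProd-square zero    = squaring 1
  partialProd-square (suc K) = begin
    (A ⊛ B ⊛ (A ⊛ B)) ⊛ E (xPow 1)     ≈⟨ regroup A B (E (xPow 1)) ⟩
    ((A ⊛ A) ⊛ E (xPow 1)) ⊛ (B ⊛ B)   ≲⟨ mod-⊛ʳ (B ⊛ B) (partialProd-square K) ⟩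
    E (xPow N) ⊛ (B ⊛ B)               ≈⟨ ⊛-comm (E (xPow N)) (B ⊛ B) ⟩
    (B ⊛ B) ⊛ E (xPow N)               ≲⟨ squaring N ⟩
    E (xPow (b ℕ.* N))                 ∎
    where
    open import Relation.Binary.Reasoning.Preorder (mod-preorder M)
    A = partialProd b K
    N = b ^ suc K
    B = oneMinusXPow N
    regroup : ∀ a b e → (a ⊛ b ⊛ (a ⊛ b)) ⊛ e ≈ ((a ⊛ a) ⊛ e) ⊛ (b ⊛ b)
    regroup = solve 3 (λ a b e → (a :* b :* (a :* b)) :* e := ((a :* a) :* e) :* (b :* b)) (λ _ → refl)

  infProd-square : 1 < b → (infProd b ⊛ infProd b) ⊛ E (xPow 1) ≈ oneS [mod M ]
  infProd-square 1<b = mk-mod λ n →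
    subst₂ (λ u v → + M ∣ u - v) (sym (truncate n)) (E-xPow-< (n<b^[1+n] 1<b n))
           (∣-diff (partialProd-square n) n)
    where
    truncate : ∀ n → ((infProd b ⊛ infProd b) ⊛ E (xPow 1)) n
                   ≡ ((partialProd b n ⊛ partialProd b n) ⊛ E (xPow 1)) n
    truncate n = ⊛-cong-upTo {g = E (xPow 1)} (⊛-cong-upTo P≈A P≈A) (λ _ _ → refl) n ℕₚ.≤-refl
      where P≈A = infProd≈partialProd 1<b n

-- Square roots modulo m

⊛-suc : ∀ f g n → (f ⊛ g) (suc n) ≡ sumTo n (λ i → f i * g (suc n ∸ i)) + f (suc n) * g 0
⊛-suc f g n = cong (λ k → sumTo n (λ i → f i * g (suc n ∸ i)) + f (suc n) * g k) (ℕₚ.n∸n≡0 n)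

∣ₛ-⊛-cancelʳ : ∀ {m} f e → e 0 ≡ 1ℤ → m ∣ₛ f ⊛ e → m ∣ₛ f
∣ₛ-⊛-cancelʳ {m} f e e₀≡1 m∣fe = <-rec _ step
  where
  f*e₀≡f : ∀ n → f n * e 0 ≡ f n
  f*e₀≡f n = trans (cong (f n *_) e₀≡1) (ℤₚ.*-identityʳ (f n))
  step : ∀ n → (∀ {i} → i < n → + m ∣ f i) → + m ∣ f n
  step zero    _  = subst (+ m ∣_) (f*e₀≡f 0) (m∣fe 0)
  step (suc n) ih = subst (+ m ∣_) (f*e₀≡f (suc n))
    (∣m+n∣m⇒∣n (subst (+ m ∣_) (⊛-suc f e n) (m∣fe (suc n)))
               (∣-sumTo n λ i i≤n → ∣m⇒∣m*n (e (suc n ∸ i)) (ih (s≤s i≤n))))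

-- Instantiated with (m, a, M) = (4, 2, 8) and (3, 1, 3).
module _ {m a M : ℕ}
  (M∣x*2⇒m∣x : ∀ x → + M ∣ x * + 2 → + m ∣ x)
  (m∣x⇒a∣y⇒M∣x*y : ∀ x y → + m ∣ x → + a ∣ y → + M ∣ x * y)
  (m∣x-y⇒a∣x+y : ∀ x y → + m ∣ x - y → + a ∣ x + y)
  where

  diff*sum-divisible⇒≈[mod] : ∀ s t → s 0 ≡ 1ℤ → t 0 ≡ 1ℤ →
    M ∣ₛ (s ⊕ ⊝ t) ⊛ (s ⊕ t) → s ≈ t [mod m ]
  diff*sum-divisible⇒≈[mod] s t s₀≡1 t₀≡1 M∣dh = mk-mod (<-rec _ step)
    where
    d h : PS
    d = s ⊕ ⊝ t
    h = s ⊕ t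
    d₀≡0 : d 0 ≡ 0ℤ
    d₀≡0 = cong₂ _-_ s₀≡1 t₀≡1
    d*h₀≡2d : ∀ n → d n * h 0 ≡ d n * + 2
    d*h₀≡2d n = cong (d n *_) (cong₂ _+_ s₀≡1 t₀≡1)
    step : ∀ n → (∀ {i} → i < n → + m ∣ d i) → + m ∣ d n
    step zero    _  = subst (+ m ∣_) (sym d₀≡0) ∣0
    step (suc n) ih = M∣x*2⇒m∣x (d (suc n)) (subst (+ M ∣_) (d*h₀≡2d (suc n))
      (∣m+n∣m⇒∣n (subst (+ M ∣_) (⊛-suc d h n) (M∣dh (suc n))) (∣-sumTo n middle)))
      where
      middle : ∀ i → i ≤ n → + M ∣ d i * h (suc n ∸ i)
      middle zero    _     = subst (λ z → + M ∣ z * h (suc n)) (sym d₀≡0) (∣m⇒∣m*n (h (suc n)) ∣0)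
      middle (suc i) 1+i≤n = m∣x⇒a∣y⇒M∣x*y _ _ (ih (s≤s 1+i≤n))
        (m∣x-y⇒a∣x+y (s (n ∸ i)) (t (n ∸ i)) (ih (s≤s (ℕₚ.m∸n≤m n i))))

  square-root-unique : ∀ e s t → e 0 ≡ 1ℤ → s 0 ≡ 1ℤ → t 0 ≡ 1ℤ →
    (s ⊛ s) ⊛ e ≈ (t ⊛ t) ⊛ e [mod M ] → s ≈ t [mod m ]
  square-root-unique e s t e₀≡1 s₀≡1 t₀≡1 (mk-mod M∣s²e-t²e) =
    diff*sum-divisible⇒≈[mod] s t s₀≡1 t₀≡1 (∣ₛ-⊛-cancelʳ ((s ⊕ ⊝ t) ⊛ (s ⊕ t)) e e₀≡1 (∣ₛ-resp-≈ (difference-of-squares s t e) M∣s²e-t²e))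
    where
    difference-of-squares : ∀ s t e → (s ⊛ s) ⊛ e ⊕ ⊝ ((t ⊛ t) ⊛ e) ≈ ((s ⊕ ⊝ t) ⊛ (s ⊕ t)) ⊛ e
    difference-of-squares = solve 3 (λ s t e → (s :* s) :* e :- (t :* t) :* e
                                              := ((s :- t) :* (s :+ t)) :* e) (λ _ → refl)

  sqrt≈infProd[mod] : ∀ b → 1 < b →
    (∀ N → (oneMinusXPow N ⊛ oneMinusXPow N) ⊛ E (xPow N) ≈ E (xPow (b ℕ.* N)) [mod M ]) →
    ∀ s → s 0 ≡ 1ℤ → (s ⊛ s) ⊛ E (xPow 1) ≈ oneS → s ≈ infProd b [mod m ]
  sqrt≈infProd[mod] b 1<b squaring s s₀≡1 s²E≈1 =
    square-root-unique (E (xPow 1)) s (infProd b) refl s₀≡1 refl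
      (mod-trans (mod-reflexive s²E≈1) (mod-sym (infProd-square squaring 1<b)))

8∣x*2⇒4∣x : ∀ x → + 8 ∣ x * + 2 → + 4 ∣ x
8∣x*2⇒4∣x _ = *-cancelʳ-∣ (+ 2)

4∣x⇒2∣y⇒8∣x*y : ∀ x y → + 4 ∣ x → + 2 ∣ y → + 8 ∣ x * y
4∣x⇒2∣y⇒8∣x*y _ _ (divides p refl) (divides q refl) = divides (p * q) (regroup p q)
  where
  regroup : ∀ p q → p * + 4 * (q * + 2) ≡ p * q * + 8
  regroup = ℤ-Solver.solve-∀

4∣x-y⇒2∣x+y : ∀ x y → + 4 ∣ x - y → + 2 ∣ x + y
4∣x-y⇒2∣x+y x y 4∣x-y =
  subst (+ 2 ∣_) (regroup x y) (∣m∣n⇒∣m+n (∣-trans (divides (+ 2) refl) 4∣x-y) (∣n⇒∣m*n y ∣-refl))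
  where
  regroup : ∀ x y → x - y + y * + 2 ≡ x + y
  regroup = ℤ-Solver.solve-∀

3∣x*2⇒3∣x : ∀ x → + 3 ∣ x * + 2 → + 3 ∣ x
3∣x*2⇒3∣x x 3∣2x =
  subst (+ 3 ∣_) (regroup x) (∣m∣n⇒∣m-n (∣m⇒∣m*n (+ 2) 3∣2x) (∣n⇒∣m*n x ∣-refl))
  where
  regroup : ∀ x → x * + 2 * + 2 - x * + 3 ≡ x
  regroup = ℤ-Solver.solve-∀

1∣x : ∀ x → + 1 ∣ x
1∣x x = divides x (sym (ℤₚ.*-identityʳ x))

≈[mod]⇒≡PS[mod] : ∀ {f g m} → f ≈ g [mod m ] → f ≡PS g [mod m ]
≈[mod]⇒≡PS[mod] (mk-mod m∣f-g) n = ∣⇒∣ᵤ (m∣f-g n)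

theorem1p4 : (s : PS) → s 0 ≡ + 1
    → (∀ n → ((s ⊛ s) ⊛ (linear (+ 1) -[1+ 0 ] ⊛ linear (+ 1) (+ 3))) n ≡ oneS n)
    → (s ≡PS infProd 2 [mod 4 ]) × (s ≡PS infProd 3 [mod 3 ])
theorem1p4 s s₀≡1 s²L≈1 =
    ≈[mod]⇒≡PS[mod] (sqrt≈infProd[mod] 8∣x*2⇒4∣x 4∣x⇒2∣y⇒8∣x*y 4∣x-y⇒2∣x+y
                       2 1<b squaring-mod-8 s s₀≡1 s²E≈1)
  , ≈[mod]⇒≡PS[mod] (sqrt≈infProd[mod] 3∣x*2⇒3∣x (λ _ y 3∣x _ → ∣m⇒∣m*n y 3∣x) (λ x y _ → 1∣x (x + y))
                       3 1<b squaring-mod-3 s s₀≡1 s²E≈1)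
  where
  1<b : ∀ {k} → 1 < suc (suc k)
  1<b = s≤s (s≤s z≤n)
  s²E≈1 : (s ⊛ s) ⊛ E (xPow 1) ≈ oneS
  s²E≈1 n = trans (⊛-congˡ (s ⊛ s) (λ k → sym (linear-product≈E k)) n) (s²L≈1 n)
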